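{- In any All or Nothing instance, no loop satisfying the All or Nothing rules visits a region that contains at least three leaves.
   Context: An All or Nothing instance is a finite rectangular grid of cells partitioned into regions (each a set of orthogonally connected cells). A loop is a non-crossing closed path (simple cycle) through orthogonally adjacent cells, each cell visited at most once. A loop satisfies the All or Nothing rules if: (1) whenever it visits some cell of a region, it passes through every cell of that region; (2) it enters and exits each region at most once, i.e. the cells of each visited region form a single contiguous segment of the loop; (3) no two orthogonally adjacent regions are both unvisited. A leaf of a region is a cell of the region that is orthogonally adjacent to exactly one other cell of the same region. -}

module Defs where

open import Data.Nat using (ℕ; zero; suc; _≤_)
open import Data.Nat.DivMod using (_%_; m%n<n)
open import Data.Fin using (Fin; toℕ; fromℕ<)
open import Data.Product using (Σ; ∃; _×_; _,_)
open import Data.Sum using (_⊎_)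
open import Relation.Binary.PropositionalEquality using (_≡_; _≢_)
open import Relation.Nullary using (¬_)

Next1 : ∀ {k} → Fin k → Fin k → Set
Next1 a b = suc (toℕ a) ≡ toℕ b ⊎ suc (toℕ b) ≡ toℕ a

Cell : ℕ → ℕ → Set
Cell m n = Fin m × Fin n

Adj : ∀ {m n} → Cell m n → Cell m n → Set
Adj (r , c) (r' , c') = (r ≡ r' × Next1 c c') ⊎ (c ≡ c' × Next1 r r')

-- y is reachable from x by orthogonal steps staying inside predicate P
-- (x itself is assumed to lie in P by the caller).
data Reach {m n} (P : Cell m n → Set) (x : Cell m n) : Cell m n → Set where
  here : Reach P x x
  step : ∀ {y z} → Reach P x y → Adj y z → P z → Reach P x z

record Instance : Set where
  field
    rows cols nreg : ℕ
    region    : Cell rows cols → Fin nreg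
    nonempty  : ∀ (r : Fin nreg) → ∃ λ x → region x ≡ r
    connected : ∀ x y → region x ≡ region y →
                Reach (λ z → region z ≡ region x) x y

open Instance public

next : ∀ {k} → Fin (suc k) → Fin (suc k)
next {k} i = fromℕ< (m%n<n (suc (toℕ i)) (suc k))

record Loop (I : Instance) : Set where
  field
    k      : ℕ
    long   : 2 ≤ k
    cell   : Fin (suc k) → Cell (rows I) (cols I)
    simple : ∀ i j → cell i ≡ cell j → i ≡ j
    closed : ∀ i → Adj (cell i) (cell (next i))

open Loop public

module _ {I : Instance} where

  Visits : Loop I → Fin (nreg I) → Set
  Visits L r = ∃ λ i → region I (cell L i) ≡ r

  ExitAt : (L : Loop I) → Fin (nreg I) → Fin (suc (k L)) → Set
  ExitAt L r i = region I (cell L i) ≡ r × region I (cell L (next i)) ≢ r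

  -- The All or Nothing rules.
  -- (1) visiting a region means passing through all of its cells;
  -- (2) each region is entered/exited at most once (at most one exit point);
  -- (3) no two adjacent distinct regions are both unvisited.
  Valid : Loop I → Set
  Valid L =
    (∀ x → Visits L (region I x) → ∃ λ i → cell L i ≡ x) ×
    (∀ r i j → ExitAt L r i → ExitAt L r j → i ≡ j) ×
    (∀ x y → Adj x y → region I x ≢ region I y →
       Visits L (region I x) ⊎ Visits L (region I y))

  Leaf : Fin (nreg I) → Cell (rows I) (cols I) → Set
  Leaf r x = region I x ≡ r ×
             ∃ λ y → Adj x y × region I y ≡ r ×
                     (∀ z → Adj x z → region I z ≡ r → z ≡ y)

  ThreeLeaves : Fin (nreg I) → Set
  ThreeLeaves r = ∃ λ a → ∃ λ b → ∃ λ c →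
    Leaf r a × Leaf r b × Leaf r c × a ≢ b × a ≢ c × b ≢ c

module Submission where

-- At a leaf visited by the loop, at most one of the two loop-neighbours lies in
-- the region: both would be the leaf's unique neighbour in the region, forcing a
-- cycle of length two.  So every visited leaf is a place where the loop leaves or
-- enters the region.  Rule (2) allows only one exit, and hence only one entry,
-- because following the loop from an entry reaches an exit and distinct entries
-- reach distinct first exits.  One exit and one entry cannot host three leaves.

open import Defs
open import Data.Empty using (⊥-elim)
open import Data.Fin using (Fin; toℕ; _≟_)
open import Data.Fin.Properties using (toℕ-injective; toℕ-fromℕ<; toℕ<n)
open import Data.Nat using (ℕ; zero; suc; _+_; _∸_; _≤_; _<_; s≤s; z≤n; NonZero; _<?_)
open import Data.Nat.DivMod
  using (_%_; m%n<n; m%n%n≡m%n; m<n⇒m%n≡m; %-distribˡ-+; [m+n]%n≡m%n; m≤n⇒[n∸m]%m≡n%m)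
open import Data.Nat.GeneralisedArithmetic using (fold; fold-+)
open import Data.Nat.Properties
  using ( +-identityʳ; +-suc; +-comm; +-cancelˡ-≡; +-mono-<; m∸n+n≡m; m<n+o⇒m∸n<o
        ; <-irrefl; ≮⇒≥; ≤-refl; ≤-total; n≤1+n; m≤n⇒m≤1+n; m≤n⇒m<n∨m≡n; m<1+n⇒m≤n )
open import Data.Product using (∃; _×_; _,_)
import Data.Product as Product
open import Data.Sum using (_⊎_; inj₁; inj₂; [_,_])
import Data.Sum as Sum
open import Function using (_∘_)
open import Level using (0ℓ)
open import Relation.Nullary using (¬_; yes; no)
open import Relation.Unary using (Pred; Decidable)
open import Relation.Binary.PropositionalEquality
  using (_≡_; _≢_; refl; sym; trans; cong; subst; module ≡-Reasoning)
open ≡-Reasoning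

[1+m%n]%n≡[1+m]%n : ∀ m n .{{_ : NonZero n}} → suc (m % n) % n ≡ suc m % n
[1+m%n]%n≡[1+m]%n m n = begin
  (1 + m % n) % n         ≡⟨ %-distribˡ-+ 1 (m % n) n ⟩
  (1 % n + m % n % n) % n ≡⟨ cong (λ x → (1 % n + x) % n) (m%n%n≡m%n m n) ⟩
  (1 % n + m % n) % n     ≡⟨ %-distribˡ-+ 1 m n ⟨
  (1 + m) % n             ∎

[m+t]%n≡m⇒t≡0 : ∀ {m t n} .{{_ : NonZero n}} → m < n → t < n → (m + t) % n ≡ m → t ≡ 0
[m+t]%n≡m⇒t≡0 {m} {t} {n} m<n t<n eq with m + t <? n
... | yes m+t<n = +-cancelˡ-≡ m t 0 (begin
  m + t       ≡⟨ m<n⇒m%n≡m m+t<n ⟨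
  (m + t) % n ≡⟨ eq ⟩
  m           ≡⟨ +-identityʳ m ⟨
  m + 0       ∎)
... | no m+t≮n = ⊥-elim (<-irrefl t≡n t<n)
  where
  n≤m+t : n ≤ m + t
  n≤m+t = ≮⇒≥ m+t≮n
  m+t∸n≡m : m + t ∸ n ≡ m
  m+t∸n≡m = begin
    m + t ∸ n       ≡⟨ m<n⇒m%n≡m (m<n+o⇒m∸n<o (m + t) n (+-mono-< m<n t<n)) ⟨
    (m + t ∸ n) % n ≡⟨ m≤n⇒[n∸m]%m≡n%m n≤m+t ⟩
    (m + t) % n     ≡⟨ eq ⟩
    m               ∎
  t≡n : t ≡ n
  t≡n = +-cancelˡ-≡ m t n (begin
    m + t         ≡⟨ m∸n+n≡m n≤m+t ⟨
    m + t ∸ n + n ≡⟨ cong (_+ n) m+t∸n≡m ⟩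
    m + n         ∎)

pigeonhole₃ : ∀ {a p q} {A : Set a} {P : Pred A p} {Q : Pred A q} →
              (∀ x y → P x → P y → x ≡ y) → (∀ x y → Q x → Q y → x ≡ y) →
              ∀ {x y z} → P x ⊎ Q x → P y ⊎ Q y → P z ⊎ Q z →
              x ≡ y ⊎ x ≡ z ⊎ y ≡ z
pigeonhole₃ uP uQ (inj₁ px) (inj₁ py) _         = inj₁ (uP _ _ px py)
pigeonhole₃ uP uQ (inj₂ qx) (inj₂ qy) _         = inj₁ (uQ _ _ qx qy)
pigeonhole₃ uP uQ (inj₁ px) (inj₂ _)  (inj₁ pz) = inj₂ (inj₁ (uP _ _ px pz))
pigeonhole₃ uP uQ (inj₂ qx) (inj₁ _)  (inj₂ qz) = inj₂ (inj₁ (uQ _ _ qx qz))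
pigeonhole₃ uP uQ (inj₁ _)  (inj₂ qy) (inj₂ qz) = inj₂ (inj₂ (uQ _ _ qy qz))
pigeonhole₃ uP uQ (inj₂ _)  (inj₁ py) (inj₁ pz) = inj₂ (inj₂ (uP _ _ py pz))

adj-sym : ∀ {m n} {x y : Cell m n} → Adj x y → Adj y x
adj-sym = Sum.map (Product.map sym Sum.swap) (Product.map sym Sum.swap)

module Cycle (n : ℕ) where

  shift : ℕ → Fin (suc n) → Fin (suc n)
  shift t i = fold i next t

  toℕ-next : ∀ i → toℕ (next i) ≡ suc (toℕ i) % suc n
  toℕ-next i = toℕ-fromℕ< (m%n<n (suc (toℕ i)) (suc n))

  toℕ-shift : ∀ t i → toℕ (shift t i) ≡ (toℕ i + t) % suc n
  toℕ-shift zero i = begin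
    toℕ i               ≡⟨ m<n⇒m%n≡m (toℕ<n i) ⟨
    toℕ i % suc n       ≡⟨ cong (_% suc n) (+-identityʳ (toℕ i)) ⟨
    (toℕ i + 0) % suc n ∎
  toℕ-shift (suc t) i = begin
    toℕ (next (shift t i))            ≡⟨ toℕ-next (shift t i) ⟩
    suc (toℕ (shift t i)) % suc n     ≡⟨ cong (λ x → suc x % suc n) (toℕ-shift t i) ⟩
    suc ((toℕ i + t) % suc n) % suc n ≡⟨ [1+m%n]%n≡[1+m]%n (toℕ i + t) (suc n) ⟩
    suc (toℕ i + t) % suc n           ≡⟨ cong (_% suc n) (+-suc (toℕ i) t) ⟨
    (toℕ i + suc t) % suc n           ∎

  shift-period : ∀ i → shift (suc n) i ≡ i
  shift-period i = toℕ-injective (begin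
    toℕ (shift (suc n) i)   ≡⟨ toℕ-shift (suc n) i ⟩
    (toℕ i + suc n) % suc n ≡⟨ [m+n]%n≡m%n (toℕ i) (suc n) ⟩
    toℕ i % suc n           ≡⟨ m<n⇒m%n≡m (toℕ<n i) ⟩
    toℕ i                   ∎)

  prev : Fin (suc n) → Fin (suc n)
  prev = shift n

  next-prev : ∀ i → next (prev i) ≡ i
  next-prev = shift-period

  prev-next : ∀ i → prev (next i) ≡ i
  prev-next i = begin
    shift n (shift 1 i) ≡⟨ fold-+ i next n ⟨
    shift (n + 1) i     ≡⟨ cong (λ t → shift t i) (+-comm n 1) ⟩
    shift (suc n) i     ≡⟨ shift-period i ⟩
    i                   ∎

  next-injective : ∀ {i j} → next i ≡ next j → i ≡ j
  next-injective {i} {j} eq = begin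
    i             ≡⟨ prev-next i ⟨
    prev (next i) ≡⟨ cong prev eq ⟩
    prev (next j) ≡⟨ prev-next j ⟩
    j             ∎

  next²≢id : 2 ≤ n → ∀ i → next (next i) ≢ i
  next²≢id 2≤n i eq with () ← [m+t]%n≡m⇒t≡0 (toℕ<n i) (s≤s 2≤n)
                               (trans (sym (toℕ-shift 2 i)) (cong toℕ eq))

  module Runs {p} (P : Pred (Fin (suc n)) p) (P? : Decidable P) where

    Exit : Pred (Fin (suc n)) p
    Exit i = P i × ¬ P (next i)

    Entry : Pred (Fin (suc n)) p
    Entry i = P i × ¬ P (prev i)

    Run : Fin (suc n) → ℕ → Set p
    Run j t = ∀ s → s ≤ t → P (shift s j)

    run-extend : ∀ {j t} → Run j t → P (shift (suc t) j) → Run j (suc t)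
    run-extend run P₊ s s≤1+t with m≤n⇒m<n∨m≡n s≤1+t
    ... | inj₁ s<1+t = run s (m<1+n⇒m≤n s<1+t)
    ... | inj₂ refl  = P₊

    run-or-exit : ∀ {j} → P j → ∀ t → Run j t ⊎ ∃ λ u → Run j u × Exit (shift u j)
    run-or-exit Pj zero = inj₁ λ { zero z≤n → Pj }
    run-or-exit {j} Pj (suc t) with run-or-exit Pj t
    ... | inj₂ exit = inj₂ exit
    ... | inj₁ run with P? (shift (suc t) j)
    ...   | yes P₊ = inj₁ (run-extend run P₊)
    ...   | no ¬P₊ = inj₂ (t , run , run t ≤-refl , ¬P₊)

    entry-reaches-exit : ∀ {j} → Entry j → ∃ λ u → Run j u × Exit (shift u j)
    entry-reaches-exit (Pj , ¬Pprev) with run-or-exit Pj n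
    ... | inj₁ run  = ⊥-elim (¬Pprev (run n ≤-refl))
    ... | inj₂ exit = exit

    entry-on-run : ∀ {i j} t u → t ≤ u → Entry i → Run j u → shift t i ≡ shift u j → i ≡ j
    entry-on-run zero zero _ _ _ eq = eq
    entry-on-run {i} {j} zero (suc u) _ (_ , ¬Pprev) run eq =
      ⊥-elim (¬Pprev (subst P prev-i≡ (run u (n≤1+n u))))
      where
      prev-i≡ : shift u j ≡ prev i
      prev-i≡ = sym (trans (cong prev eq) (prev-next (shift u j)))
    entry-on-run (suc t) (suc u) (s≤s t≤u) entry run eq =
      entry-on-run t u t≤u entry (λ s s≤u → run s (m≤n⇒m≤1+n s≤u)) (next-injective eq)

    unique-exit⇒unique-entry : (∀ i j → Exit i → Exit j → i ≡ j) →
                               ∀ i j → Entry i → Entry j → i ≡ j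
    unique-exit⇒unique-entry unique-exit i j entry-i entry-j
      with entry-reaches-exit entry-i | entry-reaches-exit entry-j
    ... | t , run-i , exit-i | u , run-j , exit-j with ≤-total t u
    ...   | inj₁ t≤u = entry-on-run t u t≤u entry-i run-j (unique-exit _ _ exit-i exit-j)
    ...   | inj₂ u≤t = sym (entry-on-run u t u≤t entry-j run-i (unique-exit _ _ exit-j exit-i))

module LoopInRegion {I : Instance} (L : Loop I) (r : Fin (nreg I)) where

  open Cycle (k L)

  InRegion : Pred (Fin (suc (k L))) 0ℓ
  InRegion i = region I (cell L i) ≡ r

  InRegion? : Decidable InRegion
  InRegion? i = region I (cell L i) ≟ r

  open Runs InRegion InRegion? public

  leaf-exit-or-entry : ∀ i → Leaf {I} r (cell L i) → Exit i ⊎ Entry i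
  leaf-exit-or-entry i (i∈r , y , _ , _ , unique-neighbour)
    with InRegion? (next i) | InRegion? (prev i)
  ... | no next∉r | _         = inj₁ (i∈r , next∉r)
  ... | yes _     | no prev∉r = inj₂ (i∈r , prev∉r)
  ... | yes next∈r | yes prev∈r =
    ⊥-elim (next²≢id (long L) (prev i)
             (trans (cong next (next-prev i)) (simple L _ _ (trans next≡y (sym prev≡y)))))
    where
    next≡y : cell L (next i) ≡ y
    next≡y = unique-neighbour _ (closed L i) next∈r
    prev→i : Adj (cell L (prev i)) (cell L i)
    prev→i = subst (Adj (cell L (prev i)) ∘ cell L) (next-prev i) (closed L (prev i))
    prev≡y : cell L (prev i) ≡ y
    prev≡y = unique-neighbour _ (adj-sym prev→i) prev∈r

  visited-leaf-on-loop : (∀ x → Visits L (region I x) → ∃ λ i → cell L i ≡ x) →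
                         Visits L r → ∀ {x} → Leaf {I} r x →
                         ∃ λ i → cell L i ≡ x × (Exit i ⊎ Entry i)
  visited-leaf-on-loop covers visits {x} leaf@(x∈r , _)
    with covers x (subst (Visits L) (sym x∈r) visits)
  ... | i , refl = i , refl , leaf-exit-or-entry i leaf

open LoopInRegion using (visited-leaf-on-loop; unique-exit⇒unique-entry)

mainTheorem3 : (I : Instance) (L : Loop I) → Valid L →
               (r : Fin (nreg I)) → ThreeLeaves {I} r → ¬ Visits L r
mainTheorem3 I L (covers , unique-exit , _) r (a , b , c , la , lb , lc , a≢b , a≢c , b≢c) visits
  with visited-leaf-on-loop L r covers visits la
     | visited-leaf-on-loop L r covers visits lb
     | visited-leaf-on-loop L r covers visits lc
... | i , refl , ci | j , refl , cj | l , refl , cl =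
  [ a≢b ∘ cong (cell L) , [ a≢c ∘ cong (cell L) , b≢c ∘ cong (cell L) ] ]
    (pigeonhole₃ (unique-exit r) (unique-exit⇒unique-entry L r (unique-exit r)) ci cj cl)
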